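{- Let $b$ be a rational number with $b\neq -1$ and let $c=1$. Then the cubic polynomials $P(x)$ and $Q(d)$ (defined in the context) are reducible over $\mathbb{Q}$. Moreover, if $b=\frac{2t}{(t-2)^2-2}$ for some rational $t$, then each of $P$ and $Q$ has three rational roots (counted with multiplicity), these roots can be labelled $x_1,x_2,x_3$ (roots of $P$) and $d_1,d_2,d_3$ (roots of $Q$) so that the auxiliary equations hold, but these six numbers are not all positive, so they do not provide a solution of the perfect cuboid problem (Problem 1.2).
   Context: Let $b,c$ be rational numbers. Put $\Delta=b^2c^4-6b^2c^3+13b^2c^2-12b^2c+4b^2+c^2$ and $N=(bc-1-b)(bc-c-2b)$, and assume $\Delta\,N\neq 0$, so that all the following rational numbers are defined (with $D=b^2c^2+2b^2-3b^2c+c-bc^2+2b$): $E_{11}=-\frac{b(c^2+2-4c)}{D}$, $E_{01}=-\frac{b(c^2+2-2c)}{D}$, $E_{10}=-\frac{b^2c^2+2b^2-3b^2c-c}{D}$; $E_{20}=\frac{b}{2}(bc^2-2c-2b)(2bc^2-c^2-6bc+2+4b)(bc-1-b)^{ -2}(bc-c-2b)^{ -2}$; $E_{02}=\frac12(28b^2c^2-16b^2c-2c^2-4b^2-b^2c^4+4b^3c^4-12b^3c^3+4bc^3+24b^3c-8bc-2b^4c^4+12b^4c^3-26b^4c^2-8b^2c^3+24b^4c-16b^3-8b^4)(bc-1-b)^{ -2}(bc-c-2b)^{ -2}$; $E_{21}=\frac{b}{2}(5c^6b-2c^6b^2+52c^5b^2-16c^5b-2c^7b^2+2b^4c^8+142b^4c^6-26b^4c^7-426b^4c^5-61b^3c^6+100b^3c^5+14c^7b^3-c^8b^3-20bc^2-8b^2c^2-16b^2c-128b^2c^4-200b^3c^3+244b^3c^2+32bc^3-112b^3c+768b^4c^4-852b^4c^3+568b^4c^2+104b^2c^3-208b^4c+8c^4-4c^3+16b^3+32b^4-2c^5)\,\Delta^{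 -1}(bc-1-b)^{ -2}(bc-c-2b)^{ -2}$; $E_{12}=(16b^6+32b^5-6c^5b^2+2c^5b-62b^5c^6+62b^6c^6-180b^6c^5+18b^5c^7-12b^6c^7-2b^5c^8+b^6c^8+248b^5c^2+248b^6c^2-96b^6c+321b^6c^4-180b^5c^3-144b^5c-360b^6c^3+b^4c^8+8b^4c^6-6b^4c^7+18b^4c^5+7b^3c^6+90b^5c^5-14b^3c^5-c^7b^3+17b^2c^4+28b^3c^3-28b^3c^2-4bc^3+8b^3c-57b^4c^4+36b^4c^3+32b^4c^2-12b^2c^3-48b^4c-c^4+16b^4)\,\Delta^{ -1}(bc-1-b)^{ -2}(bc-c-2b)^{ -2}$; $E_{03}=\frac{b}{2}(b^2c^4-5b^2c^3+10b^2c^2-10b^2c+4b^2+2bc+2c^2-bc^3)(2b^2c^4-12b^2c^3+26b^2c^2-24b^2c+8b^2-c^4b+3bc^3-6bc+4b+c^3-2c^2+2c)\,\Delta^{ -1}(bc-1-b)^{ -2}(bc-c-2b)^{ -2}$; $E_{30}=c\,b^2(1-c)(c-2)(bc^2-4bc+2+4b)(2bc^2-c^2-4bc+2b)\,\Delta^{ -1}(bc-1-b)^{ -2}(bc-c-2b)^{ -2}$. Define $P(x)=x^3-E_{10}x^2+E_{20}x-E_{30}$ and $Q(d)=d^3-E_{01}d^2+E_{02}d-E_{03}$. For numbers $x_1,x_2,x_3,d_1,d_2,d_3$ the auxiliary equations are: $x_1x_2d_3+x_2x_3d_1+x_3x_1d_2=E_{21}$, $x_1d_2+d_1x_2+x_2d_3+d_2x_3+x_3d_1+d_3x_1=E_{11}$,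 $x_1d_2d_3+x_2d_3d_1+x_3d_1d_2=E_{12}$. Problem 1.2 (equivalent to finding a perfect cuboid) asks for rational $b,c$ such that $P$ and $Q$ have positive rational roots $x_1,x_2,x_3$ and $d_1,d_2,d_3$ satisfying the auxiliary equations. -}

module Defs where

open import Data.Nat.Base using (ℕ; zero; suc)
open import Data.Rational.Base
open import Data.Rational.Properties using (_≟_)
import Data.Rational.Literals as Lit
open import Data.Unit.Base using (tt)
import Data.Nat.Literals as NLit
open import Relation.Nullary using (yes; no)
open import Relation.Binary.PropositionalEquality using (_≡_; _≢_)
open import Data.Product using (Σ; ∃; _×_; _,_)

open import Agda.Builtin.FromNat using (Number; fromNat)

instance
  ℚ-number : Number ℚ
  ℚ-number = Lit.number
  ℕ-number : Number ℕ
  ℕ-number = NLit.number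

infixr 9 _^_
_^_ : ℚ → ℕ → ℚ
p ^ zero = 1ℚ
p ^ suc n = p * p ^ n

-- total inverse on ℚ (with the convention inv 0 = 0); it is only ever
-- applied to quantities that are nonzero under the hypotheses
inv : ℚ → ℚ
inv p with p ≟ 0ℚ
... | yes _ = 0ℚ
... | no p≢0 = 1/_ p ⦃ ≢-nonZero p≢0 ⦄

Δ : ℚ → ℚ → ℚ
Δ b c = (b ^ 2 * c ^ 4 - 6 * b ^ 2 * c ^ 3 + 13 * b ^ 2 * c ^ 2 - 12 * b ^ 2 * c + 4 * b ^ 2 + c ^ 2)

N : ℚ → ℚ → ℚ
N b c = (b * c - 1 - b) * (b * c - c - 2 * b)

D : ℚ → ℚ → ℚ
D b c = (b ^ 2 * c ^ 2 + 2 * b ^ 2 - 3 * b ^ 2 * c + c - b * c ^ 2 + 2 * b)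

invN² : ℚ → ℚ → ℚ
invN² b c = inv ((b * c - 1 - b) ^ 2) * inv ((b * c - c - 2 * b) ^ 2)

E11 : ℚ → ℚ → ℚ
E11 b c = - (b * (c ^ 2 + 2 - 4 * c)) * inv (D b c)

E01 : ℚ → ℚ → ℚ
E01 b c = - (b * (c ^ 2 + 2 - 2 * c)) * inv (D b c)

E10 : ℚ → ℚ → ℚ
E10 b c = - (b ^ 2 * c ^ 2 + 2 * b ^ 2 - 3 * b ^ 2 * c - c) * inv (D b c)

E20 : ℚ → ℚ → ℚ
E20 b c = b * ½ * (b * c ^ 2 - 2 * c - 2 * b) * (2 * b * c ^ 2 - c ^ 2 - 6 * b * c + 2 + 4 * b) * invN² b c

E02 : ℚ → ℚ → ℚ
E02 b c = ½ * (28 * b ^ 2 * c ^ 2 - 16 * b ^ 2 * c - 2 * c ^ 2 - 4 * b ^ 2 - b ^ 2 * c ^ 4 + 4 * b ^ 3 * c ^ 4 - 12 * b ^ 3 * c ^ 3 + 4 * b * c ^ 3 + 24 * b ^ 3 * c - 8 * b * c - 2 * b ^ 4 * c ^ 4 + 12 * b ^ 4 * c ^ 3 - 26 * b ^ 4 * c ^ 2 - 8 * b ^ 2 * c ^ 3 + 24 * b ^ 4 * c - 16 * b ^ 3 - 8 * b ^ 4) * invN² b c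

E21 : ℚ → ℚ → ℚ
E21 b c = b * ½ * (5 * b * c ^ 6 - 2 * b ^ 2 * c ^ 6 + 52 * b ^ 2 * c ^ 5 - 16 * b * c ^ 5 - 2 * b ^ 2 * c ^ 7 + 2 * b ^ 4 * c ^ 8 + 142 * b ^ 4 * c ^ 6 - 26 * b ^ 4 * c ^ 7 - 426 * b ^ 4 * c ^ 5 - 61 * b ^ 3 * c ^ 6 + 100 * b ^ 3 * c ^ 5 + 14 * b ^ 3 * c ^ 7 - b ^ 3 * c ^ 8 - 20 * b * c ^ 2 - 8 * b ^ 2 * c ^ 2 - 16 * b ^ 2 * c - 128 * b ^ 2 * c ^ 4 - 200 * b ^ 3 * c ^ 3 + 244 * b ^ 3 * c ^ 2 + 32 * b * c ^ 3 - 112 * b ^ 3 * c + 768 * b ^ 4 * c ^ 4 - 852 * b ^ 4 * c ^ 3 + 568 * b ^ 4 * c ^ 2 + 104 * b ^ 2 * c ^ 3 - 208 * b ^ 4 * c + 8 * c ^ 4 - 4 * c ^ 3 + 16 * b ^ 3 + 32 * b ^ 4 - 2 * c ^ 5) * inv (Δ b c) * invN² b c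

E12 : ℚ → ℚ → ℚ
E12 b c = (16 * b ^ 6 + 32 * b ^ 5 - 6 * b ^ 2 * c ^ 5 + 2 * b * c ^ 5 - 62 * b ^ 5 * c ^ 6 + 62 * b ^ 6 * c ^ 6 - 180 * b ^ 6 * c ^ 5 + 18 * b ^ 5 * c ^ 7 - 12 * b ^ 6 * c ^ 7 - 2 * b ^ 5 * c ^ 8 + b ^ 6 * c ^ 8 + 248 * b ^ 5 * c ^ 2 + 248 * b ^ 6 * c ^ 2 - 96 * b ^ 6 * c + 321 * b ^ 6 * c ^ 4 - 180 * b ^ 5 * c ^ 3 - 144 * b ^ 5 * c - 360 * b ^ 6 * c ^ 3 + b ^ 4 * c ^ 8 + 8 * b ^ 4 * c ^ 6 - 6 * b ^ 4 * c ^ 7 + 18 * b ^ 4 * c ^ 5 + 7 * b ^ 3 * c ^ 6 + 90 * b ^ 5 * c ^ 5 - 14 * b ^ 3 * c ^ 5 - b ^ 3 * c ^ 7 + 17 * b ^ 2 * c ^ 4 + 28 * b ^ 3 * c ^ 3 - 28 * b ^ 3 * c ^ 2 - 4 * b * c ^ 3 + 8 * b ^ 3 * c - 57 * b ^ 4 * c ^ 4 + 36 * b ^ 4 * c ^ 3 + 32 * b ^ 4 * c ^ 2 - 12 * b ^ 2 * c ^ 3 - 48 * b ^ 4 * c - c ^ 4 + 16 * b ^ 4) * inv (Δ b c) * invN² b c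

E03 : ℚ → ℚ → ℚ
E03 b c = b * ½ * (b ^ 2 * c ^ 4 - 5 * b ^ 2 * c ^ 3 + 10 * b ^ 2 * c ^ 2 - 10 * b ^ 2 * c + 4 * b ^ 2 + 2 * b * c + 2 * c ^ 2 - b * c ^ 3) * (2 * b ^ 2 * c ^ 4 - 12 * b ^ 2 * c ^ 3 + 26 * b ^ 2 * c ^ 2 - 24 * b ^ 2 * c + 8 * b ^ 2 - b * c ^ 4 + 3 * b * c ^ 3 - 6 * b * c + 4 * b + c ^ 3 - 2 * c ^ 2 + 2 * c) * inv (Δ b c) * invN² b c

E30 : ℚ → ℚ → ℚ
E30 b c = c * b ^ 2 * (1 - c) * (c - 2) * (b * c ^ 2 - 4 * b * c + 2 + 4 * b) * (2 * b * c ^ 2 - c ^ 2 - 4 * b * c + 2 * b) * inv (Δ b c) * invN² b c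

-- A cubic  a₃ X³ + a₂ X² + a₁ X + a₀  over ℚ, given by its coefficients.
-- It is reducible over ℚ iff it is a product of two non-constant
-- polynomials over ℚ; for a cubic the factors have degrees 1 and 2, so this
-- unfolds to:  a₃X³+a₂X²+a₁X+a₀ = (u X + v)(w X² + y X + z) with u , w ≠ 0.
ReducibleCubic : ℚ → ℚ → ℚ → ℚ → Set
ReducibleCubic a₃ a₂ a₁ a₀ =
  Σ ℚ λ u → Σ ℚ λ v → Σ ℚ λ w → Σ ℚ λ y → Σ ℚ λ z →
    u ≢ 0ℚ × w ≢ 0ℚ ×
    u * w ≡ a₃ × u * y + v * w ≡ a₂ × u * z + v * y ≡ a₁ × v * z ≡ a₀

P-Reducible : ℚ → ℚ → Set
P-Reducible b c = ReducibleCubic 1ℚ (- E10 b c) (E20 b c) (- E30 b c)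

Q-Reducible : ℚ → ℚ → Set
Q-Reducible b c = ReducibleCubic 1ℚ (- E01 b c) (E02 b c) (- E03 b c)

-- x₁ , x₂ , x₃ are the roots of P counted with multiplicity, i.e.
-- P(X) = (X - x₁)(X - x₂)(X - x₃) as polynomials (comparison of coefficients)
RootsOfP : ℚ → ℚ → ℚ → ℚ → ℚ → Set
RootsOfP b c x₁ x₂ x₃ =
  x₁ + x₂ + x₃ ≡ E10 b c × x₁ * x₂ + x₂ * x₃ + x₃ * x₁ ≡ E20 b c × x₁ * x₂ * x₃ ≡ E30 b c

RootsOfQ : ℚ → ℚ → ℚ → ℚ → ℚ → Set
RootsOfQ b c d₁ d₂ d₃ =
  d₁ + d₂ + d₃ ≡ E01 b c × d₁ * d₂ + d₂ * d₃ + d₃ * d₁ ≡ E02 b c × d₁ * d₂ * d₃ ≡ E03 b c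

Auxiliary : ℚ → ℚ → ℚ → ℚ → ℚ → ℚ → ℚ → ℚ → Set
Auxiliary b c x₁ x₂ x₃ d₁ d₂ d₃ =
  x₁ * x₂ * d₃ + x₂ * x₃ * d₁ + x₃ * x₁ * d₂ ≡ E21 b c ×
  x₁ * d₂ + d₁ * x₂ + x₂ * d₃ + d₂ * x₃ + x₃ * d₁ + d₃ * x₁ ≡ E11 b c ×
  x₁ * d₂ * d₃ + x₂ * d₃ * d₁ + x₃ * d₁ * d₂ ≡ E12 b c

{-# OPTIONS --safe #-}
-- At c = 1 every coefficient is a polynomial in e = 1/(1+b): with q = (e² − 1)/2,
-- E10 = e, E20 = q, E30 = 0, E01 = e − 1, E02 = q − e, E03 = E21 = −q,
-- E11 = e² − 2q − e and E12 = 2q − e². Hence P = X·p and Q = (X+1)·p for p = X² − eX + q,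
-- so both are reducible, and if r₁, r₂ are the roots of p then Vieta's formulas show that
-- x = (0, r₁, r₂), d = (−1, r₂, r₁) satisfy the auxiliary equations. The roots of p are
-- rational iff some rational point of the unit circle r₁² + r₂² = e² − 2q = 1 has
-- r₁ + r₂ = e; for b = 2t/((t−2)² − 2) this point is (t(t−2), 2(1−t))/(t² − 2t + 2).
-- Since x₁ = 0, the six numbers are never all positive.
module Submission where

open import Defs
open import Data.Rational.Base using (ℚ; 0ℚ; 1ℚ; -_; _*_; _+_; _-_; _<_; ½; mkℚ; NonNegative; ≢-nonZero)
open import Data.Rational.Properties
  using (_≟_; +-*-commutativeRing; *-inverseʳ; *-identityˡ; *-identityʳ; *-assoc; *-comm; *-zeroˡ; <-irrefl;
         nonNeg*nonNeg⇒nonNeg; nonPos*nonPos⇒nonPos; nonNeg+pos⇒pos; positive⁻¹)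
open import Data.Integer.Base using (+_; -[1+_])
open import Data.Product using (Σ; _×_; _,_)
open import Data.List.Base using (_∷_; [])
open import Data.Empty using (⊥-elim)
open import Relation.Binary.PropositionalEquality
  using (_≡_; _≢_; refl; sym; trans; cong; cong₂; subst; module ≡-Reasoning)
open import Relation.Nullary using (¬_; yes; no)
open import Relation.Nullary.Decidable using (dec⇒maybe)
open import Agda.Builtin.FromNat using (fromNat)
open import Data.Unit.Base using (tt)
open import Tactic.RingSolver using (solve; solve-∀)
open import Tactic.RingSolver.Core.AlmostCommutativeRing using (AlmostCommutativeRing; fromCommutativeRing)

open ≡-Reasoning

ℚ-ring : AlmostCommutativeRing _ _
ℚ-ring = fromCommutativeRing +-*-commutativeRing (λ p → dec⇒maybe (0ℚ ≟ p))

inv-inverseʳ : ∀ {p} → p ≢ 0ℚ → p * inv p ≡ 1ℚ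
inv-inverseʳ {p} p≢0 with p ≟ 0ℚ
... | yes p≡0 = ⊥-elim (p≢0 p≡0)
... | no  p≢0′ = *-inverseʳ p {{≢-nonZero p≢0′}}

inv-unique : ∀ {p q} → p * q ≡ 1ℚ → inv p ≡ q
inv-unique {p} {q} pq≡1 = begin
  inv p             ≡⟨ sym (*-identityʳ (inv p)) ⟩
  inv p * 1ℚ        ≡⟨ cong (inv p *_) (sym pq≡1) ⟩
  inv p * (p * q)   ≡⟨ sym (*-assoc (inv p) p q) ⟩
  inv p * p * q     ≡⟨ cong (_* q) (trans (*-comm (inv p) p) (inv-inverseʳ p≢0)) ⟩
  1ℚ * q            ≡⟨ *-identityˡ q ⟩
  q                 ∎
  where
  p≢0 : p ≢ 0ℚ
  p≢0 p≡0 with trans (sym (*-zeroˡ q)) (trans (cong (_* q) (sym p≡0)) pq≡1)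
  ... | ()

square-nonNeg : ∀ p → NonNegative (p * p)
square-nonNeg p@(mkℚ (+ _)    _ _) = nonNeg*nonNeg⇒nonNeg p p
square-nonNeg p@(mkℚ -[1+ _ ] _ _) = nonPos*nonPos⇒nonPos p p

t²-2t+2≢0 : ∀ t → t * t - 2 * t + 2 ≢ 0ℚ
t²-2t+2≢0 t eq = <-irrefl refl (subst (0ℚ <_) completed-square 0<s²+1)
  where
  s : ℚ
  s = t - 1ℚ
  0<s²+1 : 0ℚ < s * s + 1ℚ
  0<s²+1 = positive⁻¹ (s * s + 1ℚ) {{nonNeg+pos⇒pos (s * s) {{square-nonNeg s}} 1ℚ}}
  completed-square : s * s + 1ℚ ≡ 0ℚ
  completed-square = begin
    (t - 1ℚ) * (t - 1ℚ) + 1ℚ  ≡⟨ solve (t ∷ []) ℚ-ring ⟩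
    t * t - 2 * t + 2         ≡⟨ eq ⟩
    0ℚ                        ∎

reducible-with-root-zero : ∀ {a₂ a₁ a₀ s q} →
  a₂ ≡ - s → a₁ ≡ q → a₀ ≡ 0ℚ → ReducibleCubic 1ℚ a₂ a₁ a₀
reducible-with-root-zero {s = s} {q} refl refl refl =
  1ℚ , 0ℚ , 1ℚ , - s , q , (λ ()) , (λ ()) , refl ,
  solve (s ∷ []) ℚ-ring , solve (s ∷ q ∷ []) ℚ-ring , solve (q ∷ []) ℚ-ring

reducible-with-root-minus-one : ∀ {a₂ a₁ a₀ s q} →
  a₂ ≡ - (s - 1ℚ) → a₁ ≡ q - s → a₀ ≡ - (- q) → ReducibleCubic 1ℚ a₂ a₁ a₀
reducible-with-root-minus-one {s = s} {q} refl refl refl =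
  1ℚ , 1ℚ , 1ℚ , - s , q , (λ ()) , (λ ()) , refl ,
  solve (s ∷ []) ℚ-ring , solve (s ∷ q ∷ []) ℚ-ring , solve (q ∷ []) ℚ-ring

vieta-root-zero : ∀ r₁ r₂ {s q} → r₁ + r₂ ≡ s → r₁ * r₂ ≡ q →
  0ℚ + r₁ + r₂ ≡ s ×
  0ℚ * r₁ + r₁ * r₂ + r₂ * 0ℚ ≡ q ×
  0ℚ * r₁ * r₂ ≡ 0ℚ
vieta-root-zero r₁ r₂ refl refl =
  solve (r₁ ∷ r₂ ∷ []) ℚ-ring , solve (r₁ ∷ r₂ ∷ []) ℚ-ring , solve (r₁ ∷ r₂ ∷ []) ℚ-ring

vieta-root-minus-one : ∀ r₁ r₂ {s q} → r₁ + r₂ ≡ s → r₁ * r₂ ≡ q →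
  - 1ℚ + r₂ + r₁ ≡ s - 1ℚ ×
  - 1ℚ * r₂ + r₂ * r₁ + r₁ * (- 1ℚ) ≡ q - s ×
  - 1ℚ * r₂ * r₁ ≡ - q
vieta-root-minus-one r₁ r₂ refl refl =
  solve (r₁ ∷ r₂ ∷ []) ℚ-ring , solve (r₁ ∷ r₂ ∷ []) ℚ-ring , solve (r₁ ∷ r₂ ∷ []) ℚ-ring

vieta-auxiliary : ∀ r₁ r₂ {s q} → r₁ + r₂ ≡ s → r₁ * r₂ ≡ q →
  0ℚ * r₁ * r₁ + r₁ * r₂ * (- 1ℚ) + r₂ * 0ℚ * r₂ ≡ - q ×
  0ℚ * r₂ + - 1ℚ * r₁ + r₁ * r₁ + r₂ * r₂ + r₂ * (- 1ℚ) + r₁ * 0ℚ ≡ s * s - 2 * q - s ×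
  0ℚ * r₂ * r₁ + r₁ * r₁ * (- 1ℚ) + r₂ * (- 1ℚ) * r₂ ≡ 2 * q - s * s
vieta-auxiliary r₁ r₂ refl refl =
  solve (r₁ ∷ r₂ ∷ []) ℚ-ring , solve (r₁ ∷ r₂ ∷ []) ℚ-ring , solve (r₁ ∷ r₂ ∷ []) ℚ-ring

circle-point : ∀ t m → (t * t - 2 * t + 2) * m ≡ 1ℚ →
  (t * (t - 2) * m) * (t * (t - 2) * m) + (2 * (1ℚ - t) * m) * (2 * (1ℚ - t) * m) ≡ 1ℚ
circle-point t m nm≡1 = begin
  (t * (t - 2) * m) * (t * (t - 2) * m) + (2 * (1ℚ - t) * m) * (2 * (1ℚ - t) * m)
    ≡⟨ solve (t ∷ m ∷ []) ℚ-ring ⟩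
  ((t * t - 2 * t + 2) * m) * ((t * t - 2 * t + 2) * m)
    ≡⟨ cong (λ w → w * w) nm≡1 ⟩
  1ℚ ∎

product-on-circle : ∀ r₁ r₂ → r₁ * r₁ + r₂ * r₂ ≡ 1ℚ →
  r₁ * r₂ ≡ ½ * ((r₁ + r₂) * (r₁ + r₂) - 1ℚ)
product-on-circle r₁ r₂ on-circle = begin
  r₁ * r₂
    ≡⟨ solve (r₁ ∷ r₂ ∷ []) ℚ-ring ⟩
  ½ * ((r₁ + r₂) * (r₁ + r₂) - (r₁ * r₁ + r₂ * r₂))
    ≡⟨ cong (λ w → ½ * ((r₁ + r₂) * (r₁ + r₂) - w)) on-circle ⟩
  ½ * ((r₁ + r₂) * (r₁ + r₂) - 1ℚ)
    ∎

circle-point-inverts-1+b : ∀ b t m → b * ((t - 2) ^ 2 - 2) ≡ 2 * t → (t * t - 2 * t + 2) * m ≡ 1ℚ →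
  (1ℚ + b) * (t * (t - 2) * m + 2 * (1ℚ - t) * m) ≡ 1ℚ
circle-point-inverts-1+b b t m parameter nm≡1 = begin
  (1ℚ + b) * (t * (t - 2) * m + 2 * (1ℚ - t) * m)
    ≡⟨ solve (b ∷ t ∷ m ∷ []) ℚ-ring ⟩
  ((t - 2) * ((t - 2) * 1ℚ) - 2 + b * ((t - 2) * ((t - 2) * 1ℚ) - 2)) * m
    ≡⟨ cong (λ w → ((t - 2) * ((t - 2) * 1ℚ) - 2 + w) * m) parameter ⟩
  ((t - 2) * ((t - 2) * 1ℚ) - 2 + 2 * t) * m
    ≡⟨ solve (t ∷ m ∷ []) ℚ-ring ⟩
  (t * t - 2 * t + 2) * m
    ≡⟨ nm≡1 ⟩
  1ℚ ∎

-- The formulas of Defs at c = 1, with b ^ n unfolded and the inverse factors abstracted as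
-- variables so that the ring solver can read them; instantiating the variables with the
-- inverses gives back E.. b 1ℚ by computation.
D-at-one : ∀ b →
    (b * (b * 1ℚ)) * 1ℚ + 2 * (b * (b * 1ℚ)) - 3 * (b * (b * 1ℚ)) * 1ℚ + 1ℚ - b * 1ℚ
    + 2 * b
  ≡ 1ℚ + b
D-at-one = solve-∀ ℚ-ring

Δ-at-one : ∀ b →
    (b * (b * 1ℚ)) * 1ℚ - 6 * (b * (b * 1ℚ)) * 1ℚ + 13 * (b * (b * 1ℚ)) * 1ℚ
    - 12 * (b * (b * 1ℚ)) * 1ℚ + 4 * (b * (b * 1ℚ)) + 1ℚ
  ≡ 1ℚ
Δ-at-one = solve-∀ ℚ-ring

N₁²-at-one : ∀ b →
    (b * 1ℚ - 1 - b) * ((b * 1ℚ - 1 - b) * 1ℚ)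
  ≡ 1ℚ
N₁²-at-one = solve-∀ ℚ-ring

E10-at-one : ∀ b z →
    - ((b * (b * 1ℚ)) * 1ℚ + 2 * (b * (b * 1ℚ)) - 3 * (b * (b * 1ℚ)) * 1ℚ - 1ℚ) * z
  ≡ z
E10-at-one = solve-∀ ℚ-ring

E11-at-one : ∀ b z →
    - (b * (1ℚ + 2 - 4 * 1ℚ)) * z
  ≡ (1ℚ + b) * z - z
E11-at-one = solve-∀ ℚ-ring

E01-at-one : ∀ b z →
    - (b * (1ℚ + 2 - 2 * 1ℚ)) * z
  ≡ z - (1ℚ + b) * z
E01-at-one = solve-∀ ℚ-ring

E20-at-one : ∀ b z →
    b * ½ * (b * 1ℚ - 2 * 1ℚ - 2 * b) * (2 * b * 1ℚ - 1ℚ - 6 * b * 1ℚ + 2 + 4 * b) * z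
  ≡ ½ * (1ℚ - (1ℚ + b) * (1ℚ + b)) * z
E20-at-one = solve-∀ ℚ-ring

E02-at-one : ∀ b z →
    ½ * (28 * (b * (b * 1ℚ)) * 1ℚ - 16 * (b * (b * 1ℚ)) * 1ℚ - 2 * 1ℚ - 4 * (b * (b * 1ℚ))
    - (b * (b * 1ℚ)) * 1ℚ + 4 * (b * (b * (b * 1ℚ))) * 1ℚ - 12 * (b * (b * (b * 1ℚ))) * 1ℚ
    + 4 * b * 1ℚ + 24 * (b * (b * (b * 1ℚ))) * 1ℚ - 8 * b * 1ℚ
    - 2 * (b * (b * (b * (b * 1ℚ)))) * 1ℚ + 12 * (b * (b * (b * (b * 1ℚ)))) * 1ℚ
    - 26 * (b * (b * (b * (b * 1ℚ)))) * 1ℚ - 8 * (b * (b * 1ℚ)) * 1ℚ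
    + 24 * (b * (b * (b * (b * 1ℚ)))) * 1ℚ - 16 * (b * (b * (b * 1ℚ)))
    - 8 * (b * (b * (b * (b * 1ℚ))))) * z
  ≡ (½ * (1ℚ - (1ℚ + b) * (1ℚ + b)) - (1ℚ + b)) * z
E02-at-one = solve-∀ ℚ-ring

E03-at-one : ∀ b y z →
    b * ½ * ((b * (b * 1ℚ)) * 1ℚ - 5 * (b * (b * 1ℚ)) * 1ℚ + 10 * (b * (b * 1ℚ)) * 1ℚ
    - 10 * (b * (b * 1ℚ)) * 1ℚ + 4 * (b * (b * 1ℚ)) + 2 * b * 1ℚ + 2 * 1ℚ
    - b * 1ℚ) * (2 * (b * (b * 1ℚ)) * 1ℚ - 12 * (b * (b * 1ℚ)) * 1ℚ
    + 26 * (b * (b * 1ℚ)) * 1ℚ - 24 * (b * (b * 1ℚ)) * 1ℚ + 8 * (b * (b * 1ℚ)) - b * 1ℚ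
    + 3 * b * 1ℚ - 6 * b * 1ℚ + 4 * b + 1ℚ - 2 * 1ℚ + 2 * 1ℚ) * y * z
  ≡ - (½ * (1ℚ - (1ℚ + b) * (1ℚ + b))) * y * z
E03-at-one = solve-∀ ℚ-ring

E21-at-one : ∀ b y z →
    b * ½ * (5 * b * 1ℚ - 2 * (b * (b * 1ℚ)) * 1ℚ + 52 * (b * (b * 1ℚ)) * 1ℚ - 16 * b * 1ℚ
    - 2 * (b * (b * 1ℚ)) * 1ℚ + 2 * (b * (b * (b * (b * 1ℚ)))) * 1ℚ
    + 142 * (b * (b * (b * (b * 1ℚ)))) * 1ℚ - 26 * (b * (b * (b * (b * 1ℚ)))) * 1ℚ
    - 426 * (b * (b * (b * (b * 1ℚ)))) * 1ℚ - 61 * (b * (b * (b * 1ℚ))) * 1ℚ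
    + 100 * (b * (b * (b * 1ℚ))) * 1ℚ + 14 * (b * (b * (b * 1ℚ))) * 1ℚ
    - (b * (b * (b * 1ℚ))) * 1ℚ - 20 * b * 1ℚ - 8 * (b * (b * 1ℚ)) * 1ℚ
    - 16 * (b * (b * 1ℚ)) * 1ℚ - 128 * (b * (b * 1ℚ)) * 1ℚ
    - 200 * (b * (b * (b * 1ℚ))) * 1ℚ + 244 * (b * (b * (b * 1ℚ))) * 1ℚ + 32 * b * 1ℚ
    - 112 * (b * (b * (b * 1ℚ))) * 1ℚ + 768 * (b * (b * (b * (b * 1ℚ)))) * 1ℚ
    - 852 * (b * (b * (b * (b * 1ℚ)))) * 1ℚ + 568 * (b * (b * (b * (b * 1ℚ)))) * 1ℚ
    + 104 * (b * (b * 1ℚ)) * 1ℚ - 208 * (b * (b * (b * (b * 1ℚ)))) * 1ℚ + 8 * 1ℚ - 4 * 1ℚ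
    + 16 * (b * (b * (b * 1ℚ))) + 32 * (b * (b * (b * (b * 1ℚ)))) - 2 * 1ℚ) * y * z
  ≡ - (½ * (1ℚ - (1ℚ + b) * (1ℚ + b))) * y * z
E21-at-one = solve-∀ ℚ-ring

E12-at-one : ∀ b y z →
    (16 * (b * (b * (b * (b * (b * (b * 1ℚ)))))) + 32 * (b * (b * (b * (b * (b * 1ℚ)))))
    - 6 * (b * (b * 1ℚ)) * 1ℚ + 2 * b * 1ℚ - 62 * (b * (b * (b * (b * (b * 1ℚ))))) * 1ℚ
    + 62 * (b * (b * (b * (b * (b * (b * 1ℚ)))))) * 1ℚ
    - 180 * (b * (b * (b * (b * (b * (b * 1ℚ)))))) * 1ℚ
    + 18 * (b * (b * (b * (b * (b * 1ℚ))))) * 1ℚ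
    - 12 * (b * (b * (b * (b * (b * (b * 1ℚ)))))) * 1ℚ
    - 2 * (b * (b * (b * (b * (b * 1ℚ))))) * 1ℚ
    + (b * (b * (b * (b * (b * (b * 1ℚ)))))) * 1ℚ
    + 248 * (b * (b * (b * (b * (b * 1ℚ))))) * 1ℚ
    + 248 * (b * (b * (b * (b * (b * (b * 1ℚ)))))) * 1ℚ
    - 96 * (b * (b * (b * (b * (b * (b * 1ℚ)))))) * 1ℚ
    + 321 * (b * (b * (b * (b * (b * (b * 1ℚ)))))) * 1ℚ
    - 180 * (b * (b * (b * (b * (b * 1ℚ))))) * 1ℚ
    - 144 * (b * (b * (b * (b * (b * 1ℚ))))) * 1ℚ
    - 360 * (b * (b * (b * (b * (b * (b * 1ℚ)))))) * 1ℚ + (b * (b * (b * (b * 1ℚ)))) * 1ℚ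
    + 8 * (b * (b * (b * (b * 1ℚ)))) * 1ℚ - 6 * (b * (b * (b * (b * 1ℚ)))) * 1ℚ
    + 18 * (b * (b * (b * (b * 1ℚ)))) * 1ℚ + 7 * (b * (b * (b * 1ℚ))) * 1ℚ
    + 90 * (b * (b * (b * (b * (b * 1ℚ))))) * 1ℚ - 14 * (b * (b * (b * 1ℚ))) * 1ℚ
    - (b * (b * (b * 1ℚ))) * 1ℚ + 17 * (b * (b * 1ℚ)) * 1ℚ
    + 28 * (b * (b * (b * 1ℚ))) * 1ℚ - 28 * (b * (b * (b * 1ℚ))) * 1ℚ - 4 * b * 1ℚ
    + 8 * (b * (b * (b * 1ℚ))) * 1ℚ - 57 * (b * (b * (b * (b * 1ℚ)))) * 1ℚ
    + 36 * (b * (b * (b * (b * 1ℚ)))) * 1ℚ + 32 * (b * (b * (b * (b * 1ℚ)))) * 1ℚ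
    - 12 * (b * (b * 1ℚ)) * 1ℚ - 48 * (b * (b * (b * (b * 1ℚ)))) * 1ℚ - 1ℚ
    + 16 * (b * (b * (b * (b * 1ℚ))))) * y * z
  ≡ - ((1ℚ + b) * (1ℚ + b)) * y * z
E12-at-one = solve-∀ ℚ-ring

E30-at-one : ∀ b y z →
    1ℚ * (b * (b * 1ℚ)) * (1 - 1ℚ) * (1ℚ - 2) * (b * 1ℚ - 4 * b * 1ℚ + 2
    + 4 * b) * (2 * b * 1ℚ - 1ℚ - 4 * b * 1ℚ + 2 * b) * y * z
  ≡ 0ℚ
E30-at-one = solve-∀ ℚ-ring

module AtOne {b e : ℚ} (unit : (1ℚ + b) * e ≡ 1ℚ) where

  inv-D : inv (D b 1ℚ) ≡ e
  inv-D = inv-unique {p = D b 1ℚ} (trans (cong (_* e) (D-at-one b)) unit)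

  inv-Δ : inv (Δ b 1ℚ) ≡ 1ℚ
  inv-Δ = cong inv (Δ-at-one b)

  inv-N² : invN² b 1ℚ ≡ e * e
  inv-N² = begin
    invN² b 1ℚ
      ≡⟨ cong₂ _*_ (cong inv (N₁²-at-one b)) (inv-unique {p = (b * 1ℚ - 1ℚ - 2 * b) ^ 2} N₂²e²≡1) ⟩
    1ℚ * (e * e)
      ≡⟨ *-identityˡ (e * e) ⟩
    e * e
      ∎
    where
    N₂²e²≡1 : (b * 1ℚ - 1ℚ - 2 * b) ^ 2 * (e * e) ≡ 1ℚ
    N₂²e²≡1 = begin
      (b * 1ℚ - 1ℚ - 2 * b) * ((b * 1ℚ - 1ℚ - 2 * b) * 1ℚ) * (e * e)  ≡⟨ solve (b ∷ e ∷ []) ℚ-ring ⟩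
      ((1ℚ + b) * e) * ((1ℚ + b) * e)                                   ≡⟨ cong (λ w → w * w) unit ⟩
      1ℚ                                                                 ∎

  E10≡ : E10 b 1ℚ ≡ e
  E10≡ = trans (E10-at-one b _) inv-D

  E20≡ : E20 b 1ℚ ≡ ½ * (e * e - 1ℚ)
  E20≡ = begin
    E20 b 1ℚ
      ≡⟨ E20-at-one b _ ⟩
    ½ * (1ℚ - (1ℚ + b) * (1ℚ + b)) * invN² b 1ℚ
      ≡⟨ cong (½ * (1ℚ - (1ℚ + b) * (1ℚ + b)) *_) inv-N² ⟩
    ½ * (1ℚ - (1ℚ + b) * (1ℚ + b)) * (e * e)
      ≡⟨ solve (b ∷ e ∷ []) ℚ-ring ⟩
    ½ * (e * e - ((1ℚ + b) * e) * ((1ℚ + b) * e))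
      ≡⟨ cong (λ w → ½ * (e * e - w * w)) unit ⟩
    ½ * (e * e - 1ℚ)
      ∎

  E30≡ : E30 b 1ℚ ≡ 0ℚ
  E30≡ = E30-at-one b _ _

  E01≡ : E01 b 1ℚ ≡ e - 1ℚ
  E01≡ = begin
    E01 b 1ℚ                                 ≡⟨ E01-at-one b _ ⟩
    inv (D b 1ℚ) - (1ℚ + b) * inv (D b 1ℚ)   ≡⟨ cong (λ z → z - (1ℚ + b) * z) inv-D ⟩
    e - (1ℚ + b) * e                         ≡⟨ cong (λ w → e - w) unit ⟩
    e - 1ℚ                                   ∎

  E02≡ : E02 b 1ℚ ≡ ½ * (e * e - 1ℚ) - e
  E02≡ = begin
    E02 b 1ℚ
      ≡⟨ E02-at-one b _ ⟩
    (½ * (1ℚ - (1ℚ + b) * (1ℚ + b)) - (1ℚ + b)) * invN² b 1ℚ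
      ≡⟨ cong ((½ * (1ℚ - (1ℚ + b) * (1ℚ + b)) - (1ℚ + b)) *_) inv-N² ⟩
    (½ * (1ℚ - (1ℚ + b) * (1ℚ + b)) - (1ℚ + b)) * (e * e)
      ≡⟨ solve (b ∷ e ∷ []) ℚ-ring ⟩
    ½ * (e * e - ((1ℚ + b) * e) * ((1ℚ + b) * e)) - (1ℚ + b) * e * e
      ≡⟨ cong (λ w → ½ * (e * e - w * w) - w * e) unit ⟩
    ½ * (e * e - 1ℚ) - 1ℚ * e
      ≡⟨ cong (λ w → ½ * (e * e - 1ℚ) - w) (*-identityˡ e) ⟩
    ½ * (e * e - 1ℚ) - e
      ∎

  E03≡ : E03 b 1ℚ ≡ - (½ * (e * e - 1ℚ))
  E03≡ = begin
    E03 b 1ℚ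
      ≡⟨ E03-at-one b _ _ ⟩
    - (½ * (1ℚ - (1ℚ + b) * (1ℚ + b))) * inv (Δ b 1ℚ) * invN² b 1ℚ
      ≡⟨ cong₂ (λ y z → - (½ * (1ℚ - (1ℚ + b) * (1ℚ + b))) * y * z) inv-Δ inv-N² ⟩
    - (½ * (1ℚ - (1ℚ + b) * (1ℚ + b))) * 1ℚ * (e * e)
      ≡⟨ solve (b ∷ e ∷ []) ℚ-ring ⟩
    - (½ * (e * e - ((1ℚ + b) * e) * ((1ℚ + b) * e)))
      ≡⟨ cong (λ w → - (½ * (e * e - w * w))) unit ⟩
    - (½ * (e * e - 1ℚ))
      ∎

  E21≡ : E21 b 1ℚ ≡ - (½ * (e * e - 1ℚ))
  E21≡ = trans (trans (E21-at-one b _ _) (sym (E03-at-one b _ _))) E03≡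

  E11≡ : E11 b 1ℚ ≡ e * e - 2 * (½ * (e * e - 1ℚ)) - e
  E11≡ = begin
    E11 b 1ℚ                                 ≡⟨ E11-at-one b _ ⟩
    (1ℚ + b) * inv (D b 1ℚ) - inv (D b 1ℚ)   ≡⟨ cong (λ z → (1ℚ + b) * z - z) inv-D ⟩
    (1ℚ + b) * e - e                         ≡⟨ cong (_- e) unit ⟩
    1ℚ - e                                   ≡⟨ solve (e ∷ []) ℚ-ring ⟩
    e * e - 2 * (½ * (e * e - 1ℚ)) - e       ∎

  E12≡ : E12 b 1ℚ ≡ 2 * (½ * (e * e - 1ℚ)) - e * e
  E12≡ = begin
    E12 b 1ℚ
      ≡⟨ E12-at-one b _ _ ⟩
    - ((1ℚ + b) * (1ℚ + b)) * inv (Δ b 1ℚ) * invN² b 1ℚ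
      ≡⟨ cong₂ (λ y z → - ((1ℚ + b) * (1ℚ + b)) * y * z) inv-Δ inv-N² ⟩
    - ((1ℚ + b) * (1ℚ + b)) * 1ℚ * (e * e)
      ≡⟨ solve (b ∷ e ∷ []) ℚ-ring ⟩
    - (((1ℚ + b) * e) * ((1ℚ + b) * e))
      ≡⟨ cong (λ w → - (w * w)) unit ⟩
    - 1ℚ
      ≡⟨ solve (e ∷ []) ℚ-ring ⟩
    2 * (½ * (e * e - 1ℚ)) - e * e
      ∎

  P-reducible : P-Reducible b 1ℚ
  P-reducible = reducible-with-root-zero (cong -_ E10≡) E20≡ (cong -_ E30≡)

  Q-reducible : Q-Reducible b 1ℚ
  Q-reducible = reducible-with-root-minus-one (cong -_ E01≡) E02≡ (cong -_ E03≡)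

  module _ (r₁ r₂ : ℚ) (sum : r₁ + r₂ ≡ e) (product : r₁ * r₂ ≡ ½ * (e * e - 1ℚ)) where

    roots-of-P : RootsOfP b 1ℚ 0ℚ r₁ r₂
    roots-of-P =
      let σ₁ , σ₂ , σ₃ = vieta-root-zero r₁ r₂ sum product
      in trans σ₁ (sym E10≡) , trans σ₂ (sym E20≡) , trans σ₃ (sym E30≡)

    roots-of-Q : RootsOfQ b 1ℚ (- 1ℚ) r₂ r₁
    roots-of-Q =
      let σ₁ , σ₂ , σ₃ = vieta-root-minus-one r₁ r₂ sum product
      in trans σ₁ (sym E01≡) , trans σ₂ (sym E02≡) , trans σ₃ (sym E03≡)

    auxiliary : Auxiliary b 1ℚ 0ℚ r₁ r₂ (- 1ℚ) r₂ r₁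
    auxiliary =
      let σ₁ , σ₂ , σ₃ = vieta-auxiliary r₁ r₂ sum product
      in trans σ₁ (sym E21≡) , trans σ₂ (sym E11≡) , trans σ₃ (sym E12≡)

rational-roots-not-all-positive : ∀ b t → b * ((t - 2) ^ 2 - 2) ≡ 2 * t →
  Σ ℚ λ x₁ → Σ ℚ λ x₂ → Σ ℚ λ x₃ → Σ ℚ λ d₁ → Σ ℚ λ d₂ → Σ ℚ λ d₃ →
    RootsOfP b 1ℚ x₁ x₂ x₃ × RootsOfQ b 1ℚ d₁ d₂ d₃ ×
    Auxiliary b 1ℚ x₁ x₂ x₃ d₁ d₂ d₃ ×
    ¬ (0ℚ < x₁ × 0ℚ < x₂ × 0ℚ < x₃ × 0ℚ < d₁ × 0ℚ < d₂ × 0ℚ < d₃)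
rational-roots-not-all-positive b t parameter =
  0ℚ , r₁ , r₂ , - 1ℚ , r₂ , r₁ ,
  roots-of-P r₁ r₂ refl product , roots-of-Q r₁ r₂ refl product , auxiliary r₁ r₂ refl product ,
  λ (0<0 , _) → <-irrefl refl 0<0
  where
  m r₁ r₂ : ℚ
  m  = inv (t * t - 2 * t + 2)
  r₁ = t * (t - 2) * m
  r₂ = 2 * (1ℚ - t) * m

  nm≡1 : (t * t - 2 * t + 2) * m ≡ 1ℚ
  nm≡1 = inv-inverseʳ (t²-2t+2≢0 t)

  product : r₁ * r₂ ≡ ½ * ((r₁ + r₂) * (r₁ + r₂) - 1ℚ)
  product = product-on-circle r₁ r₂ (circle-point t m nm≡1)

  open AtOne {b} {r₁ + r₂} (circle-point-inverts-1+b b t m parameter nm≡1)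

theorem4p1 : (b : ℚ) → b ≢ - 1ℚ →
    (P-Reducible b 1ℚ × Q-Reducible b 1ℚ) ×
    ((t : ℚ) → b * ((t - 2) ^ 2 - 2) ≡ 2 * t →
      Σ ℚ λ x₁ → Σ ℚ λ x₂ → Σ ℚ λ x₃ → Σ ℚ λ d₁ → Σ ℚ λ d₂ → Σ ℚ λ d₃ →
        RootsOfP b 1ℚ x₁ x₂ x₃ × RootsOfQ b 1ℚ d₁ d₂ d₃ ×
        Auxiliary b 1ℚ x₁ x₂ x₃ d₁ d₂ d₃ ×
        ¬ (0ℚ < x₁ × 0ℚ < x₂ × 0ℚ < x₃ × 0ℚ < d₁ × 0ℚ < d₂ × 0ℚ < d₃))
theorem4p1 b b≢-1 = (P-reducible , Q-reducible) , rational-roots-not-all-positive b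
  where
  1+b≢0 : 1ℚ + b ≢ 0ℚ
  1+b≢0 eq = b≢-1 (begin
    b              ≡⟨ solve (b ∷ []) ℚ-ring ⟩
    1ℚ + b - 1ℚ    ≡⟨ cong (_- 1ℚ) eq ⟩
    - 1ℚ           ∎)

  open AtOne {b} {inv (1ℚ + b)} (inv-inverseʳ 1+b≢0)
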